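{- Let $A[1..N]$ be an array of anchors satisfying the Equal Match Length property, i.e. $I.b-I.a=I.d-I.c$ for every anchor $I$ in $A$. Then \[ \max_{1\leq i \leq N}\ \max_{\text{chains } S^i \text{ ending at } A[i]} \mathtt{coverage}(S^i)\;=\;\max_{1\leq i \leq N}\ \max_{\text{weak chains } S^i \text{ ending at } A[i]} \mathtt{coverage}(S^i), \] that is, the overall maximum symmetric ordered coverage over chains equals the overall maximum symmetric weakly ordered coverage over weak chains.
   Context: An anchor is an interval pair $I=([I.a..I.b],[I.c..I.d])$ with positive integer endpoints, $I.a\le I.b$, $I.c\le I.d$ (it represents a match between $T[I.a..I.b]$ and $P[I.c..I.d]$ for strings $T,P$). Precedence: $I'\prec I$ iff $I'.a<I.a$, $I'.b<I.b$, $I'.c<I.c$ and $I'.d<I.d$. Weak precedence: $I'\prec^w I$ iff $I'.a<I.a$ and $I'.c<I.c$. A chain ending at $A[i]$ is a sequence $S[1..n]$ ($n\ge1$) of anchors taken from $A$ with $S[j-1]\prec S[j]$ for all $1<j\le n$ and $S[n]=A[i]$; a weak chain ending at $A[i]$ is defined the same way with $\prec$ replaced by $\prec^w$. For such a sequence, \[ \mathtt{coverage}(S)=\sum_{j=1}^{n-1}\min\Big(\min(S[j+1].a,S[j].b+1)-S[j].a,\ \min(S[j+1].c,S[j].d+1)-S[j].c\Big)+\min\big(S[n].b-S[n].a+1,\ S[n].d-S[n].c+1\big). \] -}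

module Defs where

open import Data.Nat using (ℕ; zero; suc; _+_; _∸_; _≤_; _<_; _⊓_)
open import Data.Fin using (Fin)
open import Data.List using (List; []; _∷_; _∷ʳ_; map)
open import Data.List.Relation.Unary.Linked using (Linked)
open import Data.Product using (Σ; _×_; ∃)
open import Relation.Binary.PropositionalEquality using (_≡_)

record Anchor : Set where
  constructor anchor
  field
    a b c d : ℕ
    a-pos : 1 ≤ a
    b-pos : 1 ≤ b
    c-pos : 1 ≤ c
    d-pos : 1 ≤ d
    a≤b : a ≤ b
    c≤d : c ≤ d
open Anchor public

_≺_ : Anchor → Anchor → Set
I' ≺ I = (a I' < a I) × (b I' < b I) × (c I' < c I) × (d I' < d I)

_≺ʷ_ : Anchor → Anchor → Set
I' ≺ʷ I = (a I' < a I) × (c I' < c I)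

EqualMatchLength : Anchor → Set
EqualMatchLength I = b I ∸ a I ≡ d I ∸ c I

-- coverage of a sequence of anchors (the subtractions are always
-- non-negative for (weak) chains, so truncated subtraction is exact)
coverage : List Anchor → ℕ
coverage [] = 0
coverage (x ∷ []) = ((b x ∸ a x) + 1) ⊓ ((d x ∸ c x) + 1)
coverage (x ∷ y ∷ rest) =
  (((a y ⊓ (b x + 1)) ∸ a x) ⊓ ((c y ⊓ (d x + 1)) ∸ c x)) + coverage (y ∷ rest)

-- A sequence S = ps ++ [i] of indices into A, all consecutive pairs related
-- by R (on the anchors), i.e. an R-chain ending at A[i].
ChainWith : {N : ℕ} → (Anchor → Anchor → Set) → (Fin N → Anchor) →
            Fin N → List (Fin N) → Set
ChainWith R A i ps = Linked (λ x y → R (A x) (A y)) (ps ∷ʳ i)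

anchorsOf : {N : ℕ} → (Fin N → Anchor) → Fin N → List (Fin N) → List Anchor
anchorsOf A i ps = map A (ps ∷ʳ i)

IsMaxCoverage : {N : ℕ} → (Anchor → Anchor → Set) → (Fin N → Anchor) → ℕ → Set
IsMaxCoverage {N} R A v =
  (Σ (Fin N) λ i → Σ (List (Fin N)) λ ps →
      ChainWith R A i ps × coverage (anchorsOf A i ps) ≡ v)
  × ((i : Fin N) (ps : List (Fin N)) →
      ChainWith R A i ps → coverage (anchorsOf A i ps) ≤ v)

-- Every chain is a weak chain, so it suffices to turn any weak chain into a
-- chain of at least the same coverage.  Working from the back, put each anchor
-- x in front of an already strengthened chain starting with y: either x ≺ y,
-- or y ends within x in T or in P.  In the latter case y can be deleted: with
-- equal match lengths the text and pattern lengths of x coincide, so x and y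
-- together cover no more past x.a (resp. x.c) than x alone does.  The maximum
-- over weak chains exists because their a-coordinates strictly increase, so
-- there are only finitely many of them.

module Submission where

open import Defs
open import Data.Nat using (ℕ; _≤_; zero; suc; _+_; _∸_; _<_; _⊓_; _<?_; z≤n; s≤s)
open import Data.Nat.Properties
open import Data.Fin using (Fin; zero)
open import Data.Product using (Σ; _×_; _,_; proj₁; proj₂; map₂)
open import Data.Sum using (_⊎_; inj₁; inj₂)
open import Data.List using (List; []; _∷_; _∷ʳ_; map; length; concatMap; allFin; cartesianProduct; filter)
open import Data.List.Extrema.Nat using (argmax; argmax-all; f[xs]≤f[argmax]; max; v≤max⁺)
open import Data.List.Properties using (length-++)
open import Data.List.Relation.Unary.All using (lookup)
open import Data.List.Relation.Unary.All.Properties using (all-filter)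
open import Data.List.Relation.Unary.Any using (here; there)
import Data.List.Relation.Unary.Any as Any
open import Data.List.Relation.Unary.Linked using (Linked; []; [-]; _∷_; linked?)
import Data.List.Relation.Unary.Linked as Linked
open import Data.List.Relation.Unary.Linked.Properties using (map⁺)
open import Data.List.Membership.Propositional using (_∈_)
open import Data.List.Membership.Propositional.Properties
  using (∈-map⁺; ∈-concatMap⁺; ∈-allFin; ∈-cartesianProduct⁺; ∈-filter⁺)
open import Function using (_on_; _∘_)
open import Level using (0ℓ)
open import Relation.Nullary using (yes; no)
open import Relation.Nullary.Decidable using (_×-dec_)
open import Relation.Unary using (Pred; Decidable)
open import Relation.Binary using (Rel; Transitive)
open import Relation.Binary.PropositionalEquality using (_≡_; refl; sym; cong; cong₂; subst; module ≡-Reasoning)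

textLength patternLength : Anchor → ℕ
textLength x = b x + 1 ∸ a x
patternLength x = d x + 1 ∸ c x

EqualMatchLength⇒textLength≡patternLength : ∀ x → EqualMatchLength x → textLength x ≡ patternLength x
EqualMatchLength⇒textLength≡patternLength x eml = begin
  b x + 1 ∸ a x    ≡⟨ +-∸-comm 1 (a≤b x) ⟩
  b x ∸ a x + 1    ≡⟨ cong (_+ 1) eml ⟩
  d x ∸ c x + 1    ≡⟨ +-∸-comm 1 (c≤d x) ⟨
  d x + 1 ∸ c x    ∎
  where open ≡-Reasoning

coverage-singleton : ∀ x → coverage (x ∷ []) ≡ textLength x ⊓ patternLength x
coverage-singleton x = sym (cong₂ _⊓_ (+-∸-comm 1 (a≤b x)) (+-∸-comm 1 (c≤d x)))

contribution : Anchor → Anchor → ℕ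
contribution x y = ((a y ⊓ (b x + 1)) ∸ a x) ⊓ ((c y ⊓ (d x + 1)) ∸ c x)

module _ (x y : Anchor) where

  contribution≤textGap : contribution x y ≤ a y ∸ a x
  contribution≤textGap = ≤-trans (m⊓n≤m _ _) (∸-monoˡ-≤ (a x) (m⊓n≤m _ _))

  contribution≤textLength : contribution x y ≤ textLength x
  contribution≤textLength = ≤-trans (m⊓n≤m _ _) (∸-monoˡ-≤ (a x) (m⊓n≤n _ _))

  contribution≤patternGap : contribution x y ≤ c y ∸ c x
  contribution≤patternGap = ≤-trans (m⊓n≤n _ _) (∸-monoˡ-≤ (c x) (m⊓n≤m _ _))

  contribution≤patternLength : contribution x y ≤ patternLength x
  contribution≤patternLength = ≤-trans (m⊓n≤n _ _) (∸-monoˡ-≤ (c x) (m⊓n≤n _ _))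

  ≤-contribution : ∀ {m} → m ≤ a y ∸ a x → m ≤ textLength x →
                   m ≤ c y ∸ c x → m ≤ patternLength x → m ≤ contribution x y
  ≤-contribution m≤tg m≤tl m≤pg m≤pl = ⊓-glb
    (≤-trans (⊓-glb m≤tg m≤tl) (≤-reflexive (sym (∸-distribʳ-⊓ (a x) (a y) (b x + 1)))))
    (≤-trans (⊓-glb m≤pg m≤pl) (≤-reflexive (sym (∸-distribʳ-⊓ (c x) (c y) (d x + 1)))))

∸-telescope : ∀ {p q w} → p ≤ q → q ≤ w → (q ∸ p) + (w ∸ q) ≡ w ∸ p
∸-telescope {p} {q} {w} p≤q q≤w = begin
  (q ∸ p) + (w ∸ q)  ≡⟨ +-comm (q ∸ p) (w ∸ q) ⟩
  (w ∸ q) + (q ∸ p)  ≡⟨ +-∸-assoc (w ∸ q) p≤q ⟨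
  (w ∸ q) + q ∸ p    ≡⟨ cong (_∸ p) (m∸n+n≡m q≤w) ⟩
  w ∸ p              ∎
  where open ≡-Reasoning

+-≤-telescope : ∀ {u v p q w} → p ≤ q → q ≤ w → u ≤ q ∸ p → v ≤ w ∸ q → u + v ≤ w ∸ p
+-≤-telescope p≤q q≤w u≤ v≤ = ≤-trans (+-mono-≤ u≤ v≤) (≤-reflexive (∸-telescope p≤q q≤w))

Linked-bypass : ∀ {X : Set} {R : Rel X 0ℓ} {x y ys} → Transitive R →
                R x y → Linked R (y ∷ ys) → Linked R (x ∷ ys)
Linked-bypass trans Rxy [-]         = [-]
Linked-bypass trans Rxy (Ryz ∷ Rzs) = trans Rxy Ryz ∷ Rzs

≺⇒≺ʷ : ∀ {x y} → x ≺ y → x ≺ʷ y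
≺⇒≺ʷ (a< , _ , c< , _) = a< , c<

≺ʷ-trans : ∀ {x y z} → x ≺ʷ y → y ≺ʷ z → x ≺ʷ z
≺ʷ-trans (a₁ , c₁) (a₂ , c₂) = <-trans a₁ a₂ , <-trans c₁ c₂

EndsWithin : Anchor → Anchor → Set
EndsWithin y x = b y ≤ b x ⊎ d y ≤ d x

≺ʷ⇒≺⊎EndsWithin : ∀ {x y} → x ≺ʷ y → x ≺ y ⊎ EndsWithin y x
≺ʷ⇒≺⊎EndsWithin {x} {y} (a< , c<) with b x <? b y | d x <? d y
... | yes b< | yes d< = inj₁ (a< , b< , c< , d<)
... | no b≮  | _      = inj₂ (inj₁ (≮⇒≥ b≮))
... | yes _  | no d≮  = inj₂ (inj₂ (≮⇒≥ d≮))

-- The coordinate in which y ends within x bounds one length of x, and equal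
-- match length transfers the bound to the other.
endsWithin-absorbed : ∀ {x y v} → EqualMatchLength x → x ≺ʷ y → EndsWithin y x →
                      v ≤ textLength y → v ≤ patternLength y →
                      contribution x y + v ≤ textLength x × contribution x y + v ≤ patternLength x
endsWithin-absorbed {x} {y} eml (a< , c<) ends v≤tl v≤pl with ends
... | inj₁ b≤ = ≤tl , ≤-trans ≤tl (≤-reflexive tl≡pl)
  where
  tl≡pl = EqualMatchLength⇒textLength≡patternLength x eml
  ≤tl = ≤-trans
    (+-≤-telescope (<⇒≤ a<) (m≤n⇒m≤n+o 1 (a≤b y)) (contribution≤textGap x y) v≤tl)
    (∸-monoˡ-≤ (a x) (+-monoˡ-≤ 1 b≤))
... | inj₂ d≤ = ≤-trans ≤pl (≤-reflexive (sym tl≡pl)) , ≤pl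
  where
  tl≡pl = EqualMatchLength⇒textLength≡patternLength x eml
  ≤pl = ≤-trans
    (+-≤-telescope (<⇒≤ c<) (m≤n⇒m≤n+o 1 (c≤d y)) (contribution≤patternGap x y) v≤pl)
    (∸-monoˡ-≤ (c x) (+-monoˡ-≤ 1 d≤))

contribution-shortcut : ∀ {x y z} → EqualMatchLength x → x ≺ʷ y → y ≺ʷ z → EndsWithin y x →
                        contribution x y + contribution y z ≤ contribution x z
contribution-shortcut {x} {y} {z} eml x≺ʷy@(a₁ , c₁) (a₂ , c₂) ends =
  ≤-contribution x z
    (+-≤-telescope (<⇒≤ a₁) (<⇒≤ a₂) (contribution≤textGap x y) (contribution≤textGap y z))
    (proj₁ absorbed)
    (+-≤-telescope (<⇒≤ c₁) (<⇒≤ c₂) (contribution≤patternGap x y) (contribution≤patternGap y z))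
    (proj₂ absorbed)
  where
  absorbed = endsWithin-absorbed {x} {y} eml x≺ʷy ends
    (contribution≤textLength y z) (contribution≤patternLength y z)

coverage-drop : ∀ {x y ws} → EqualMatchLength x → x ≺ʷ y → EndsWithin y x →
                Linked _≺ʷ_ (y ∷ ws) → coverage (x ∷ y ∷ ws) ≤ coverage (x ∷ ws)
coverage-drop {x} {y} {[]} eml x≺ʷy ends [-] =
  ≤-trans (⊓-glb (proj₁ absorbed) (proj₂ absorbed)) (≤-reflexive (sym (coverage-singleton x)))
  where
  cov-y = coverage-singleton y
  absorbed = endsWithin-absorbed {x} {y} eml x≺ʷy ends
    (≤-trans (≤-reflexive cov-y) (m⊓n≤m _ _))
    (≤-trans (≤-reflexive cov-y) (m⊓n≤n _ _))
coverage-drop {x} {y} {z ∷ ws} eml x≺ʷy ends (y≺ʷz ∷ _) =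
  subst (_≤ contribution x z + coverage (z ∷ ws))
    (+-assoc (contribution x y) (contribution y z) (coverage (z ∷ ws)))
    (+-monoˡ-≤ (coverage (z ∷ ws)) (contribution-shortcut {x} {y} {z} eml x≺ʷy y≺ʷz ends))

module Strengthening {I : Set} (A : I → Anchor) (eml : ∀ i → EqualMatchLength (A i)) where

  Improvement : I → List I → Set
  Improvement x xs = Σ (List I) λ ys →
    Linked (_≺_ on A) (x ∷ ys) × coverage (map A (x ∷ xs)) ≤ coverage (map A (x ∷ ys))

  weaken : ∀ {xs} → Linked (_≺_ on A) xs → Linked (_≺ʷ_ on A) xs
  weaken = Linked.map (λ {i} {j} → ≺⇒≺ʷ {A i} {A j})

  bypass : ∀ {x y ys} → (_≺ʷ_ on A) x y → Linked (_≺ʷ_ on A) (y ∷ ys) → Linked (_≺ʷ_ on A) (x ∷ ys)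
  bypass = Linked-bypass (λ {i} {j} {k} → ≺ʷ-trans {A i} {A j} {A k})

  prepend : ∀ x ys → Linked (_≺ʷ_ on A) (x ∷ ys) → Linked (_≺_ on A) ys → Improvement x ys
  prepend x []       _              _      = [] , [-] , ≤-refl
  prepend x (y ∷ ys) (x≺ʷy ∷ y∷ys) strong with ≺ʷ⇒≺⊎EndsWithin {A x} {A y} x≺ʷy
  ... | inj₁ x≺y  = y ∷ ys , x≺y ∷ strong , ≤-refl
  ... | inj₂ ends with prepend x ys (bypass x≺ʷy y∷ys) (Linked.tail strong)
  ...   | zs , x∷zs , improved =
    zs , x∷zs , ≤-trans (coverage-drop (eml x) x≺ʷy ends (map⁺ {R = _≺ʷ_} y∷ys)) improved

  strengthen : ∀ x xs → Linked (_≺ʷ_ on A) (x ∷ xs) → Improvement x xs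
  strengthen x []       _              = [] , [-] , ≤-refl
  strengthen x (y ∷ xs) (x≺ʷy ∷ y∷xs) with strengthen y xs y∷xs
  ... | ys , y∷ys , improved with prepend x (y ∷ ys) (x≺ʷy ∷ weaken y∷ys) y∷ys
  ...   | zs , x∷zs , improved′ =
    zs , x∷zs , ≤-trans (+-monoʳ-≤ (contribution (A x) (A y)) improved) improved′

∷-as-∷ʳ : ∀ {X : Set} (x : X) ys → Σ (List X) λ ps → Σ X λ i → ps ∷ʳ i ≡ x ∷ ys
∷-as-∷ʳ x []       = [] , x , refl
∷-as-∷ʳ x (y ∷ ys) with ∷-as-∷ʳ y ys
... | ps , i , eq = x ∷ ps , i , cong (x ∷_) eq

module _ {N : ℕ} (A : Fin N → Anchor) where

  ChainCovering : (Anchor → Anchor → Set) → ℕ → Set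
  ChainCovering R m = Σ (Fin N) λ i → Σ (List (Fin N)) λ ps →
    ChainWith R A i ps × m ≤ coverage (anchorsOf A i ps)

  module _ (eml : ∀ i → EqualMatchLength (A i)) where
    open Strengthening A eml

    improvement⇒ChainCovering : ∀ {x xs} → Improvement x xs →
                                ChainCovering _≺_ (coverage (map A (x ∷ xs)))
    improvement⇒ChainCovering {x} (ys , x∷ys , improved) with ∷-as-∷ʳ x ys
    ... | ps , i , eq =
      i , ps , subst (Linked (_≺_ on A)) (sym eq) x∷ys ,
      subst (λ zs → _ ≤ coverage (map A zs)) (sym eq) improved

    strengthenChain : ∀ {i ps} → ChainWith _≺ʷ_ A i ps → ChainCovering _≺_ (coverage (anchorsOf A i ps))
    strengthenChain {i} {[]}     ch = improvement⇒ChainCovering {i} {[]} (strengthen i [] ch)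
    strengthenChain {i} {p ∷ ps} ch =
      improvement⇒ChainCovering {p} {ps ∷ʳ i} (strengthen p (ps ∷ʳ i) ch)

IsMaxCoverage-transfer : ∀ {N} {A : Fin N → Anchor} {R R′ : Anchor → Anchor → Set} {v} →
  (∀ {x y} → R x y → R′ x y) →
  (∀ {i ps} → ChainWith R′ A i ps → ChainCovering A R (coverage (anchorsOf A i ps))) →
  IsMaxCoverage R′ A v → IsMaxCoverage R A v
IsMaxCoverage-transfer {A = A} {R} {R′} R⇒R′ improve ((i , ps , ch , refl) , maximal) with improve ch
... | i′ , ps′ , ch′ , improved =
  (i′ , ps′ , ch′ , ≤-antisym (maximal i′ ps′ (weaken ch′)) improved) ,
  λ j qs c → maximal j qs (weaken c)
  where
  weaken : ∀ {j qs} → ChainWith R A j qs → ChainWith R′ A j qs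
  weaken = Linked.map (λ {x} {y} → R⇒R′ {A x} {A y})

module _ {X : Set} {P : Pred X 0ℓ} (P? : Decidable P) (f : X → ℕ) where

  maximum-of-listed : (xs : List X) → (∀ {x} → P x → x ∈ xs) → ∀ {x₀} → P x₀ →
                      Σ X λ x → P x × (∀ {y} → P y → f y ≤ f x)
  maximum-of-listed xs listed {x₀} Px₀ =
    argmax f x₀ (filter P? xs) ,
    argmax-all f Px₀ (all-filter P? xs) ,
    λ Py → lookup (f[xs]≤f[argmax] x₀ (filter P? xs)) (∈-filter⁺ P? (listed Py) Py)

listsOfLength≤ : ∀ {X : Set} → List X → ℕ → List (List X)
listsOfLength≤ xs zero    = [] ∷ []
listsOfLength≤ xs (suc k) = [] ∷ concatMap (λ x → map (x ∷_) (listsOfLength≤ xs k)) xs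

∈-listsOfLength≤ : ∀ {X : Set} {xs : List X} → (∀ x → x ∈ xs) →
                   ∀ {k} ys → length ys ≤ k → ys ∈ listsOfLength≤ xs k
∈-listsOfLength≤ complete {zero}  []       _            = here refl
∈-listsOfLength≤ complete {suc k} []       _            = here refl
∈-listsOfLength≤ complete {suc k} (y ∷ ys) (s≤s |ys|≤k) =
  there (∈-concatMap⁺ (λ x → map (x ∷_) (listsOfLength≤ _ k))
    (Any.map (λ { refl → ∈-map⁺ (y ∷_) (∈-listsOfLength≤ complete ys |ys|≤k) }) (complete y)))

length≤bound : ∀ {X : Set} {g : X → ℕ} {B} → (∀ x → g x < B) →
               ∀ {xs} → Linked (_<_ on g) xs → length xs ≤ B
length≤bound         g<B {[]}    _     = z≤n
length≤bound {g = g} {B} g<B {_ ∷ _} chain = ≤-trans (m≤m+n _ _) (go chain)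
  where
  go : ∀ {x xs} → Linked (_<_ on g) (x ∷ xs) → length (x ∷ xs) + g x ≤ B
  go {x} [-]               = g<B x
  go {x} {y ∷ ys} (gx<gy ∷ chain) = begin
    suc (length (y ∷ ys)) + g x ≡⟨ +-suc (length (y ∷ ys)) (g x) ⟨
    length (y ∷ ys) + suc (g x) ≤⟨ +-monoʳ-≤ (length (y ∷ ys)) gx<gy ⟩
    length (y ∷ ys) + g y       ≤⟨ go chain ⟩
    B                           ∎
    where open ≤-Reasoning

module _ {N : ℕ} (A : Fin N → Anchor) where

  WeakChain : Pred (Fin N × List (Fin N)) 0ℓ
  WeakChain (i , ps) = ChainWith _≺ʷ_ A i ps

  weakChain? : Decidable WeakChain
  weakChain? (i , ps) =
    linked? (λ u v → (a (A u) <? a (A v)) ×-dec (c (A u) <? c (A v))) (ps ∷ʳ i)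

  aBound : ℕ
  aBound = suc (max 0 (map (a ∘ A) (allFin N)))

  a<aBound : ∀ j → a (A j) < aBound
  a<aBound j = s≤s (v≤max⁺ 0 (map (a ∘ A) (allFin N))
    (inj₂ (Any.map ≤-reflexive (∈-map⁺ (a ∘ A) (∈-allFin j)))))

  weakChain-length : ∀ {i ps} → ChainWith _≺ʷ_ A i ps → length ps ≤ aBound
  weakChain-length {i} {ps} ch = begin
    length ps                ≤⟨ m≤m+n (length ps) 1 ⟩
    length ps + 1            ≡⟨ length-++ ps ⟨
    length (ps ∷ʳ i)         ≤⟨ length≤bound a<aBound (Linked.map proj₁ ch) ⟩
    aBound                   ∎
    where open ≤-Reasoning

  weakChainCandidates : List (Fin N × List (Fin N))
  weakChainCandidates = cartesianProduct (allFin N) (listsOfLength≤ (allFin N) aBound)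

  ∈-weakChainCandidates : ∀ {i ps} → WeakChain (i , ps) → (i , ps) ∈ weakChainCandidates
  ∈-weakChainCandidates {i} {ps} ch =
    ∈-cartesianProduct⁺ (∈-allFin i) (∈-listsOfLength≤ ∈-allFin ps (weakChain-length ch))

  maxWeakCoverage : Fin N → Σ ℕ (IsMaxCoverage _≺ʷ_ A)
  maxWeakCoverage i₀ = fromMaximum
    (maximum-of-listed weakChain? weakCoverage weakChainCandidates ∈-weakChainCandidates
      {i₀ , []} [-])
    where
    weakCoverage : Fin N × List (Fin N) → ℕ
    weakCoverage (i , ps) = coverage (anchorsOf A i ps)

    fromMaximum : Σ _ (λ x → WeakChain x × (∀ {y} → WeakChain y → weakCoverage y ≤ weakCoverage x)) →
                  Σ ℕ (IsMaxCoverage _≺ʷ_ A)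
    fromMaximum ((i , ps) , ch , maximal) =
      weakCoverage (i , ps) , (i , ps , ch , refl) , λ j qs c → maximal c

lemma1 : (N : ℕ) → 1 ≤ N → (A : Fin N → Anchor) →
         ((i : Fin N) → EqualMatchLength (A i)) →
         Σ ℕ λ v → IsMaxCoverage _≺_ A v × IsMaxCoverage _≺ʷ_ A v
lemma1 (suc n) _ A eml = map₂ (λ isMaxʷ → strengthenMax isMaxʷ , isMaxʷ) (maxWeakCoverage A zero)
  where
  strengthenMax : ∀ {v} → IsMaxCoverage _≺ʷ_ A v → IsMaxCoverage _≺_ A v
  strengthenMax = IsMaxCoverage-transfer (λ {x} {y} → ≺⇒≺ʷ {x} {y}) (strengthenChain A eml)
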